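{- Let $G$ be an $n$-vertex $K_4$-free graph with a weight function $w : E(G) \to (0,1]$. If $G$ contains no triangle in which all three edges have weight strictly greater than $3/4$, then $w(G) \le \frac{8}{13} + o(1)$, where $o(1) \to 0$ as $n \to \infty$.
   Context: For an $n$-vertex graph $G$ with edge weights $w$, $w(G) := \frac{2}{n^2}\sum_{e \in E(G)} w(e)$.
   Formalization: The edge weights take rational values in (0,1]. -}

module Defs where

open import Data.Nat as ℕ using (ℕ; zero; suc; _<ᵇ_)
open import Data.Fin using (Fin; zero; suc; toℕ)
open import Data.Bool using (Bool; true; false; if_then_else_; _∧_)
open import Data.Integer using (+_)
open import Data.Rational using (ℚ; 0ℚ; _+_; _*_; _/_; _<_; _≤_)
open import Relation.Binary.PropositionalEquality using (_≡_; _≢_)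

record Graph (n : ℕ) : Set where
  field
    adj       : Fin n → Fin n → Bool
    adj-sym   : ∀ i j → adj i j ≡ adj j i
    adj-irrefl : ∀ i → adj i i ≡ false

open Graph public

K4-free : ∀ {n} → Graph n → Set
K4-free {n} G = (a b c d : Fin n) →
  adj G a b ≡ true → adj G a c ≡ true → adj G a d ≡ true →
  adj G b c ≡ true → adj G b d ≡ true → adj G c d ≡ true → Data.Empty.⊥
  where import Data.Empty

-- A weight function w : E(G) → (0,1].  Represented as a symmetric function on
-- vertex pairs; only its values on edges matter, and those lie in (0,1].
record Weighting {n : ℕ} (G : Graph n) : Set where
  field
    wt      : Fin n → Fin n → ℚ
    wt-sym  : ∀ i j → wt i j ≡ wt j i
    wt-pos  : ∀ i j → adj G i j ≡ true → 0ℚ < wt i j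
    wt-le1  : ∀ i j → adj G i j ≡ true → wt i j ≤ (+ 1) / 1

open Weighting public

NoHeavyTriangle : ∀ {n} (G : Graph n) → Weighting G → Set
NoHeavyTriangle {n} G w = (a b c : Fin n) →
  adj G a b ≡ true → adj G a c ≡ true → adj G b c ≡ true →
  (+ 3) / 4 < wt w a b → (+ 3) / 4 < wt w a c → (+ 3) / 4 < wt w b c →
  Data.Empty.⊥
  where import Data.Empty

sumFin : (n : ℕ) → (Fin n → ℚ) → ℚ
sumFin zero    f = 0ℚ
sumFin (suc n) f = f zero + sumFin n (λ i → f (suc i))

edgeWeightSum : ∀ {n} (G : Graph n) → Weighting G → ℚ
edgeWeightSum {n} G w =
  sumFin n (λ i → sumFin n (λ j →
    if (toℕ i <ᵇ toℕ j) ∧ adj G i j then wt w i j else 0ℚ))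

-- w(G) := (2 / n²) Σ_{e ∈ E(G)} w(e)   (set to 0 for the empty vertex set).
density : ∀ {n} (G : Graph n) → Weighting G → ℚ
density {zero}  G w = 0ℚ
density {suc m} G w = ((+ 2) / (suc m ℕ.* suc m)) * edgeWeightSum G w

-- Zykov symmetrisation of the Lagrangian  Q(x) = Σ_{a,b} W_ab x_a x_b  of the weight matrix W, for
-- which Q(1,…,1) = 2 Σ_e w(e).  If W_ij = 0 then W vanishes on {i,j}², so Q is affine along e_i − e_j;
-- moving the whole mass of j onto whichever of i, j has the larger (W x)-coordinate does not decrease Q
-- and keeps Σ x, after which j can be deleted.  Hence Q(x) ≤ c (Σ x)² for all x ≥ 0 as soon as this
-- holds on the cliques of W.  A K₄-free clique has at most three vertices, one of its edges has weight
-- at most 3/4, and on such a triangle the bound with c = 8/13 is a sum-of-squares identity.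
module Submission where

open import Algebra.Bundles using (CommutativeRing)
open import Data.Bool using (true; false; if_then_else_; T; _∧_)
open import Data.Empty using (⊥; ⊥-elim)
open import Data.Fin using (Fin; zero; suc; punchIn; toℕ)
open import Data.Fin.Patterns using (0F; 1F; 2F; 3F)
open import Data.Fin.Properties using (punchInᵢ≢i; any?; toℕ-injective) renaming (_≟_ to _≟ᶠ_)
open import Data.Integer as ℤ using (+_)
import Data.Integer.Properties as ℤ
open import Data.Integer.Tactic.RingSolver using () renaming (solve-∀ to ℤ-solve-∀)
open import Data.Nat as ℕ using (ℕ; zero; suc; _≥_; _<ᵇ_)
import Data.Nat.Properties as ℕ
open import Data.Product using (∃-syntax; _×_; _,_)
open import Data.Rational using (ℚ; 0ℚ; 1ℚ; _+_; _*_; _-_; -_; _/_; _≤_; _<_; toℚᵘ; nonNegative)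
open import Data.Rational.Properties
open import Data.Rational.Unnormalised as ℚᵘ using (mkℚᵘ; *≡*) renaming (_≃_ to _≃ᵘ_)
import Data.Rational.Unnormalised.Properties as ℚᵘ
open import Data.Sum using (inj₁; inj₂)
open import Data.Vec.Functional using (Vector; removeAt; replicate)
open import Function using (_∘_)
open import Relation.Binary.PropositionalEquality
open import Relation.Nullary using (Dec; yes; no; does)
open import Relation.Nullary.Decidable using (dec-true; dec-false; dec⇒maybe; ¬?; _×-dec_)
import Tactic.RingSolver as RingSolver
import Tactic.RingSolver.Core.AlmostCommutativeRing as ACR

open import Defs

open import Algebra.Properties.Semiring.Sum (CommutativeRing.semiring +-*-commutativeRing)

ℚ-ring : ACR.AlmostCommutativeRing _ _
ℚ-ring = ACR.fromCommutativeRing +-*-commutativeRing (λ p → dec⇒maybe (0ℚ ≟ p))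

open RingSolver using (solve-∀)

2ℚ ¾ : ℚ
2ℚ = + 2 / 1
¾  = + 3 / 4

*-nonNeg : ∀ {p q} → 0ℚ ≤ p → 0ℚ ≤ q → 0ℚ ≤ p * q
*-nonNeg {p} {q} 0≤p 0≤q =
  nonNegative⁻¹ _ {{nonNeg*nonNeg⇒nonNeg p {{nonNegative 0≤p}} q {{nonNegative 0≤q}}}}

*-monoˡ-≤-nonNeg′ : ∀ {r p q} → 0ℚ ≤ r → p ≤ q → r * p ≤ r * q
*-monoˡ-≤-nonNeg′ {r} 0≤r = *-monoˡ-≤-nonNeg r {{nonNegative 0≤r}}

p≤q⇒0≤q-p : ∀ {p q} → p ≤ q → 0ℚ ≤ q - p
p≤q⇒0≤q-p {p} {q} p≤q = subst (_≤ q - p) (+-inverseʳ p) (+-monoˡ-≤ (- p) p≤q)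

p≤p+q : ∀ {p q} → 0ℚ ≤ q → p ≤ p + q
p≤p+q {p} {q} 0≤q = subst (_≤ p + q) (+-identityʳ p) (+-monoʳ-≤ p 0≤q)

square-nonNeg : ∀ p → 0ℚ ≤ p * p
square-nonNeg p with ≤-total 0ℚ p
... | inj₁ 0≤p = *-nonNeg 0≤p 0≤p
... | inj₂ p≤0 = subst (0ℚ ≤_) (neg*neg p) (*-nonNeg 0≤-p 0≤-p)
  where
  0≤-p = neg-antimono-≤ p≤0
  neg*neg : ∀ p → - p * - p ≡ p * p
  neg*neg = solve-∀ ℚ-ring

sumFin≡sum : ∀ n (f : Vector ℚ n) → sumFin n f ≡ sum f
sumFin≡sum zero    f = refl
sumFin≡sum (suc n) f = cong (_+_ (f zero)) (sumFin≡sum n (f ∘ suc))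

infix 8 _·_

_·_ : ∀ {n} → Vector ℚ n → Vector ℚ n → ℚ
x · y = sum λ a → x a * y a

·-comm : ∀ {n} (x y : Vector ℚ n) → x · y ≡ y · x
·-comm x y = sum-cong-≗ λ a → *-comm (x a) (y a)

·-congʳ : ∀ {n} (x : Vector ℚ n) {y z : Vector ℚ n} → y ≗ z → x · y ≡ x · z
·-congʳ x y≗z = sum-cong-≗ λ a → cong (x a *_) (y≗z a)

·-affine : ∀ {n} (x u v g : Vector ℚ n) c →
           (λ a → x a + c * (u a - v a)) · g ≡ x · g + c * (u · g - v · g)
·-affine {n} x u v g c = begin
  (λ a → x a + c * (u a - v a)) · g
    ≡⟨ sum-cong-≗ (λ a → expand (x a) (u a) (v a) (g a) c) ⟩
  ∑[ a < n ] (x a * g a + (c * (u a * g a) + - c * (v a * g a)))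
    ≡⟨ ∑-distrib-+ (λ a → x a * g a) (λ a → c * (u a * g a) + - c * (v a * g a)) ⟩
  x · g + ∑[ a < n ] (c * (u a * g a) + - c * (v a * g a))
    ≡⟨ cong (_+_ (x · g)) (∑-distrib-+ (λ a → c * (u a * g a)) (λ a → - c * (v a * g a))) ⟩
  x · g + (∑[ a < n ] (c * (u a * g a)) + ∑[ a < n ] (- c * (v a * g a)))
    ≡⟨ cong (_+_ (x · g)) (cong₂ _+_ (*-distribˡ-sum c (λ a → u a * g a))
                                     (*-distribˡ-sum (- c) (λ a → v a * g a))) ⟨
  x · g + (c * (u · g) + - c * (v · g))
    ≡⟨ collect (x · g) (u · g) (v · g) c ⟩
  x · g + c * (u · g - v · g) ∎
  where
  open ≡-Reasoning
  expand : ∀ x u v g c → (x + c * (u - v)) * g ≡ x * g + (c * (u * g) + - c * (v * g))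
  expand = solve-∀ ℚ-ring
  collect : ∀ s t r c → s + (c * t + - c * r) ≡ s + c * (t - r)
  collect = solve-∀ ℚ-ring

δ : ∀ {n} → Fin n → Fin n → ℚ
δ i a = if does (i ≟ᶠ a) then 1ℚ else 0ℚ

δ-diag : ∀ {n} (i : Fin n) → δ i i ≡ 1ℚ
δ-diag i = cong (if_then 1ℚ else 0ℚ) (dec-true (i ≟ᶠ i) refl)

δ-off : ∀ {n} {i a : Fin n} → i ≢ a → δ i a ≡ 0ℚ
δ-off {i = i} {a} i≢a = cong (if_then 1ℚ else 0ℚ) (dec-false (i ≟ᶠ a) i≢a)

δ-nonNeg : ∀ {n} (i a : Fin n) → 0ℚ ≤ δ i a
δ-nonNeg i a with does (i ≟ᶠ a)
... | true  = nonNegative⁻¹ 1ℚ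
... | false = ≤-refl

δ-· : ∀ {n} (i : Fin n) (g : Vector ℚ n) → δ i · g ≡ g i
δ-· {suc n} i g = begin
  δ i · g
    ≡⟨ sum-remove {i = i} (λ a → δ i a * g a) ⟩
  δ i i * g i + ∑[ a < n ] (δ i (punchIn i a) * g (punchIn i a))
    ≡⟨ cong₂ _+_ (cong (_* g i) (δ-diag i)) (trans (sum-cong-≗ off-diagonal) (sum-replicate-zero n)) ⟩
  1ℚ * g i + 0ℚ
    ≡⟨ trans (+-identityʳ _) (*-identityˡ (g i)) ⟩
  g i ∎
  where
  open ≡-Reasoning
  off-diagonal : ∀ a → δ i (punchIn i a) * g (punchIn i a) ≡ 0ℚ
  off-diagonal a = trans (cong (_* g (punchIn i a)) (δ-off (punchInᵢ≢i i a ∘ sym)))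
                         (*-zeroˡ (g (punchIn i a)))

transfer : ∀ {n} → Fin n → Fin n → Vector ℚ n → Vector ℚ n
transfer i j x a = x a + x j * (δ i a - δ j a)

·-transfer : ∀ {n} (i j : Fin n) (x g : Vector ℚ n) →
             transfer i j x · g ≡ x · g + x j * (g i - g j)
·-transfer i j x g = trans (·-affine x (δ i) (δ j) g (x j))
  (cong (λ t → x · g + x j * t) (cong₂ _-_ (δ-· i g) (δ-· j g)))

sum-transfer : ∀ {n} (i j : Fin n) (x : Vector ℚ n) → sum (transfer i j x) ≡ sum x
sum-transfer {n} i j x = begin
  sum (transfer i j x)  ≡⟨ sum-cong-≗ (λ a → *-identityʳ (transfer i j x a)) ⟨
  transfer i j x · 1s   ≡⟨ ·-transfer i j x 1s ⟩
  x · 1s + x j * 0ℚ     ≡⟨ trans (cong (_+_ (x · 1s)) (*-zeroʳ (x j))) (+-identityʳ (x · 1s)) ⟩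
  x · 1s                ≡⟨ sum-cong-≗ (λ a → *-identityʳ (x a)) ⟩
  sum x                 ∎
  where
  open ≡-Reasoning
  1s = replicate n 1ℚ

transfer-source : ∀ {n} {i j : Fin n} (x : Vector ℚ n) → i ≢ j → transfer i j x j ≡ 0ℚ
transfer-source {i = i} {j} x i≢j = begin
  x j + x j * (δ i j - δ j j)  ≡⟨ cong₂ (λ u v → x j + x j * (u - v)) (δ-off i≢j) (δ-diag j) ⟩
  x j + x j * (0ℚ - 1ℚ)        ≡⟨ cancel (x j) ⟩
  0ℚ                           ∎
  where
  open ≡-Reasoning
  cancel : ∀ y → y + y * (0ℚ - 1ℚ) ≡ 0ℚ
  cancel = solve-∀ ℚ-ring

transfer-nonNeg : ∀ {n} {i j : Fin n} {x : Vector ℚ n} → i ≢ j →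
                  (∀ a → 0ℚ ≤ x a) → ∀ a → 0ℚ ≤ transfer i j x a
transfer-nonNeg {i = i} {j} {x} i≢j x≥0 a = by-cases (j ≟ᶠ a)
  where
  minus-zero : ∀ p q d → p + q * d ≡ p + q * (d - 0ℚ)
  minus-zero = solve-∀ ℚ-ring
  by-cases : Dec (j ≡ a) → 0ℚ ≤ transfer i j x a
  by-cases (yes refl) = ≤-reflexive (sym (transfer-source x i≢j))
  by-cases (no j≢a)   = begin
    0ℚ                        ≤⟨ +-mono-≤ (x≥0 a) (*-nonNeg (x≥0 j) (δ-nonNeg i a)) ⟩
    x a + x j * δ i a         ≡⟨ minus-zero (x a) (x j) (δ i a) ⟩
    x a + x j * (δ i a - 0ℚ)  ≡⟨ cong (λ v → x a + x j * (δ i a - v)) (δ-off j≢a) ⟨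
    transfer i j x a          ∎
    where open ≤-Reasoning

Matrix : ℕ → Set
Matrix n = Fin n → Fin n → ℚ

Symmetric : ∀ {n} → Matrix n → Set
Symmetric W = ∀ a b → W a b ≡ W b a

Hollow : ∀ {n} → Matrix n → Set
Hollow W = ∀ a → W a a ≡ 0ℚ

IsClique : ∀ {n} → Matrix n → Set
IsClique W = ∀ a b → a ≢ b → W a b ≢ 0ℚ

infixr 9 _*ᵥ_

_*ᵥ_ : ∀ {n} → Matrix n → Vector ℚ n → Vector ℚ n
(W *ᵥ x) a = x · W a

quad : ∀ {n} → Matrix n → Vector ℚ n → ℚ
quad W x = x · (W *ᵥ x)

QuadBound : ℚ → ∀ {n} → Matrix n → Set
QuadBound c {n} W = ∀ (x : Vector ℚ n) → (∀ a → 0ℚ ≤ x a) → quad W x ≤ c * (sum x * sum x)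

module _ {n} {W : Matrix n} (symmetric : Symmetric W) (hollow : Hollow W)
         {i j : Fin n} (non-edge : W i j ≡ 0ℚ) (x : Vector ℚ n) where

  private
    x′ = transfer i j x
    g  = W *ᵥ x

  *ᵥ-transfer : ∀ a → (W *ᵥ x′) a ≡ g a + x j * (W i a - W j a)
  *ᵥ-transfer a = trans (·-transfer i j x (W a))
    (cong (λ t → g a + x j * t) (cong₂ _-_ (symmetric a i) (symmetric a j)))

  *ᵥ-transfer-endpoint : ∀ {k} → W i k ≡ 0ℚ → W j k ≡ 0ℚ → (W *ᵥ x′) k ≡ g k
  *ᵥ-transfer-endpoint {k} Wik≡0 Wjk≡0 = begin
    (W *ᵥ x′) k                  ≡⟨ *ᵥ-transfer k ⟩
    g k + x j * (W i k - W j k)  ≡⟨ cong₂ (λ u v → g k + x j * (u - v)) Wik≡0 Wjk≡0 ⟩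
    g k + x j * (0ℚ - 0ℚ)        ≡⟨ vanish (g k) (x j) ⟩
    g k                          ∎
    where
    open ≡-Reasoning
    vanish : ∀ p q → p + q * (0ℚ - 0ℚ) ≡ p
    vanish = solve-∀ ℚ-ring

  quad-transfer : quad W x′ ≡ quad W x + 2ℚ * (x j * (g i - g j))
  quad-transfer = begin
    x′ · (W *ᵥ x′)
      ≡⟨ ·-congʳ x′ *ᵥ-transfer ⟩
    x′ · (λ a → g a + x j * (W i a - W j a))
      ≡⟨ ·-comm x′ _ ⟩
    (λ a → g a + x j * (W i a - W j a)) · x′
      ≡⟨ ·-affine g (W i) (W j) x′ (x j) ⟩
    g · x′ + x j * (W i · x′ - W j · x′)
      ≡⟨ cong₂ (λ u v → u + x j * v) (trans (·-comm g x′) (·-transfer i j x g)) (cong₂ _-_ at-i at-j) ⟩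
    (quad W x + x j * (g i - g j)) + x j * (g i - g j)
      ≡⟨ double (quad W x) (x j * (g i - g j)) ⟩
    quad W x + 2ℚ * (x j * (g i - g j)) ∎
    where
    open ≡-Reasoning
    at-i : W i · x′ ≡ g i
    at-i = trans (·-comm (W i) x′) (*ᵥ-transfer-endpoint (hollow i) (trans (symmetric j i) non-edge))
    at-j : W j · x′ ≡ g j
    at-j = trans (·-comm (W j) x′) (*ᵥ-transfer-endpoint non-edge (hollow j))
    double : ∀ q t → (q + t) + t ≡ q + 2ℚ * t
    double = solve-∀ ℚ-ring

  quad-transfer-mono : (∀ a → 0ℚ ≤ x a) → g j ≤ g i → quad W x ≤ quad W x′
  quad-transfer-mono x≥0 gj≤gi = subst (quad W x ≤_) (sym quad-transfer) (p≤p+q gain≥0)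
    where
    gain≥0 : 0ℚ ≤ 2ℚ * (x j * (g i - g j))
    gain≥0 = *-nonNeg (nonNegative⁻¹ 2ℚ) (*-nonNeg (x≥0 j) (p≤q⇒0≤q-p gj≤gi))

deleteVertex : ∀ {n} → Fin (suc n) → Matrix (suc n) → Matrix n
deleteVertex j W a b = W (punchIn j a) (punchIn j b)

sum-removeAt : ∀ {n} (x : Vector ℚ (suc n)) {j} → x j ≡ 0ℚ → sum x ≡ sum (removeAt x j)
sum-removeAt x {j} xj≡0 = trans (sum-remove {i = j} x)
  (trans (cong (_+ sum (removeAt x j)) xj≡0) (+-identityˡ (sum (removeAt x j))))

·-removeAt : ∀ {n} (x y : Vector ℚ (suc n)) {j} → x j ≡ 0ℚ →
             x · y ≡ removeAt x j · removeAt y j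
·-removeAt x y {j} xj≡0 =
  sum-removeAt (λ a → x a * y a) (trans (cong (_* y j) xj≡0) (*-zeroˡ (y j)))

quad-deleteVertex : ∀ {n} (W : Matrix (suc n)) (x : Vector ℚ (suc n)) {j} → x j ≡ 0ℚ →
                    quad W x ≡ quad (deleteVertex j W) (removeAt x j)
quad-deleteVertex W x {j} xj≡0 = trans (·-removeAt x (W *ᵥ x) xj≡0)
  (·-congʳ (removeAt x j) λ a → ·-removeAt x (W (punchIn j a)) xj≡0)

module Symmetrisation
  (Admissible : ∀ {n} → Matrix n → Set)
  (admissible⇒symmetric : ∀ {n} {W : Matrix n} → Admissible W → Symmetric W)
  (admissible⇒hollow : ∀ {n} {W : Matrix n} → Admissible W → Hollow W)
  (admissible-deleteVertex : ∀ {n} {W : Matrix (suc n)} j →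
                             Admissible W → Admissible (deleteVertex j W))
  (c : ℚ)
  (clique-bound : ∀ {n} {W : Matrix n} → Admissible W → IsClique W → QuadBound c W)
  where

  transfer-bound : ∀ {n} {W : Matrix (suc n)} {i j} → Admissible W → QuadBound c (deleteVertex j W) →
                   i ≢ j → W i j ≡ 0ℚ → ∀ x → (∀ a → 0ℚ ≤ x a) → (W *ᵥ x) j ≤ (W *ᵥ x) i →
                   quad W x ≤ c * (sum x * sum x)
  transfer-bound {W = W} {i} {j} adm bound i≢j non-edge x x≥0 gj≤gi = begin
    quad W x
      ≤⟨ quad-transfer-mono (admissible⇒symmetric adm) (admissible⇒hollow adm) non-edge x x≥0 gj≤gi ⟩
    quad W x′
      ≡⟨ quad-deleteVertex W x′ (transfer-source x i≢j) ⟩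
    quad (deleteVertex j W) (removeAt x′ j)
      ≤⟨ bound (removeAt x′ j) (transfer-nonNeg i≢j x≥0 ∘ punchIn j) ⟩
    c * (sum (removeAt x′ j) * sum (removeAt x′ j))
      ≡⟨ cong (λ s → c * (s * s)) sum-preserved ⟩
    c * (sum x * sum x) ∎
    where
    open ≤-Reasoning
    x′ = transfer i j x
    sum-preserved : sum (removeAt x′ j) ≡ sum x
    sum-preserved = trans (sym (sum-removeAt x′ (transfer-source x i≢j))) (sum-transfer i j x)

  non-edge? : ∀ {n} (W : Matrix n) → Dec (∃[ i ] ∃[ j ] i ≢ j × W i j ≡ 0ℚ)
  non-edge? W = any? λ i → any? λ j → ¬? (i ≟ᶠ j) ×-dec (W i j ≟ 0ℚ)

  quad-bound : ∀ n {W : Matrix n} → Admissible W → QuadBound c W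
  quad-bound n {W} adm x x≥0 with non-edge? W
  ... | no no-non-edge =
    clique-bound adm (λ i j i≢j Wij≡0 → no-non-edge (i , j , i≢j , Wij≡0)) x x≥0
  quad-bound (suc n) {W} adm x x≥0 | yes (i , j , i≢j , Wij≡0)
    with ≤-total ((W *ᵥ x) j) ((W *ᵥ x) i)
  ... | inj₁ gj≤gi =
    transfer-bound adm (quad-bound n (admissible-deleteVertex j adm)) i≢j Wij≡0 x x≥0 gj≤gi
  ... | inj₂ gi≤gj =
    transfer-bound adm (quad-bound n (admissible-deleteVertex i adm)) (i≢j ∘ sym)
                   (trans (admissible⇒symmetric adm j i) Wij≡0) x x≥0 gi≤gj

upper : ∀ {n} → Matrix n → Vector ℚ n → Fin n → Fin n → ℚ
upper W x a b = if toℕ a <ᵇ toℕ b then x a * x b * W a b else 0ℚ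

upperSum : ∀ {n} → Matrix n → Vector ℚ n → ℚ
upperSum {n} W x = ∑[ a < n ] ∑[ b < n ] upper W x a b

<ᵇ-true⇒< : ∀ {m n} → (m <ᵇ n) ≡ true → m ℕ.< n
<ᵇ-true⇒< {m} {n} m<ᵇn = ℕ.<ᵇ⇒< m n (subst T (sym m<ᵇn) _)

<ᵇ-false⇒≥ : ∀ {m n} → (m <ᵇ n) ≡ false → n ℕ.≤ m
<ᵇ-false⇒≥ m≮ᵇn = ℕ.≮⇒≥ λ m<n → subst T m≮ᵇn (ℕ.<⇒<ᵇ m<n)

upper-split : ∀ {n} {W : Matrix n} (x : Vector ℚ n) → Symmetric W → Hollow W →
              ∀ a b → x a * (x b * W a b) ≡ upper W x a b + upper W x b a
upper-split {W = W} x symmetric hollow a b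
  with toℕ a <ᵇ toℕ b in a<b | toℕ b <ᵇ toℕ a in b<a
... | true  | true  = ⊥-elim (ℕ.<-asym (<ᵇ-true⇒< {toℕ a} a<b) (<ᵇ-true⇒< {toℕ b} b<a))
... | true  | false = reassoc (x a) (x b) (W a b)
  where
  reassoc : ∀ p q w → p * (q * w) ≡ p * q * w + 0ℚ
  reassoc = solve-∀ ℚ-ring
... | false | true  = trans (swap (x a) (x b) (W a b)) (cong (λ w → 0ℚ + x b * x a * w) (symmetric a b))
  where
  swap : ∀ p q w → p * (q * w) ≡ 0ℚ + q * p * w
  swap = solve-∀ ℚ-ring
... | false | false = trans (cong (λ w → x a * (x b * w)) diagonal) (annihilate (x a) (x b))
  where
  a≡b : a ≡ b
  a≡b = toℕ-injective (ℕ.≤-antisym (<ᵇ-false⇒≥ {toℕ b} b<a) (<ᵇ-false⇒≥ {toℕ a} a<b))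
  diagonal : W a b ≡ 0ℚ
  diagonal = trans (cong (λ c → W c b) a≡b) (hollow b)
  annihilate : ∀ p q → p * (q * 0ℚ) ≡ 0ℚ + 0ℚ
  annihilate = solve-∀ ℚ-ring

quad≡2*upperSum : ∀ {n} {W : Matrix n} (x : Vector ℚ n) → Symmetric W → Hollow W →
                  quad W x ≡ 2ℚ * upperSum W x
quad≡2*upperSum {n} {W} x symmetric hollow = begin
  quad W x
    ≡⟨ sum-cong-≗ (λ a → *-distribˡ-sum (x a) (λ b → x b * W a b)) ⟩
  ∑[ a < n ] ∑[ b < n ] (x a * (x b * W a b))
    ≡⟨ sum-cong-≗ (λ a → sum-cong-≗ (upper-split x symmetric hollow a)) ⟩
  ∑[ a < n ] ∑[ b < n ] (upper W x a b + upper W x b a)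
    ≡⟨ sum-cong-≗ (λ a → ∑-distrib-+ (upper W x a) (λ b → upper W x b a)) ⟩
  ∑[ a < n ] (∑[ b < n ] upper W x a b + ∑[ b < n ] upper W x b a)
    ≡⟨ ∑-distrib-+ (λ a → ∑[ b < n ] upper W x a b) (λ a → ∑[ b < n ] upper W x b a) ⟩
  upperSum W x + ∑[ a < n ] ∑[ b < n ] upper W x b a
    ≡⟨ cong (_+_ (upperSum W x)) (∑-comm (λ a b → upper W x b a)) ⟩
  upperSum W x + upperSum W x
    ≡⟨ double (upperSum W x) ⟩
  2ℚ * upperSum W x ∎
  where
  open ≡-Reasoning
  double : ∀ s → s + s ≡ 2ℚ * s
  double = solve-∀ ℚ-ring

-- Equality holds at a = ¾, b = c = 1 and (x, y, z) ∝ (4, 4, 5).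
light-triangle-bound : ∀ {x y z a b c} → 0ℚ ≤ x → 0ℚ ≤ y → 0ℚ ≤ z → a ≤ ¾ → b ≤ 1ℚ → c ≤ 1ℚ →
                       x * y * a + x * z * b + y * z * c ≤ (+ 4 / 13) * ((x + y + z) * (x + y + z))
light-triangle-bound {x} {y} {z} {a} {b} {c} 0≤x 0≤y 0≤z a≤¾ b≤1 c≤1 = begin
  x * y * a + x * z * b + y * z * c
    ≤⟨ +-mono-≤ (+-mono-≤ (*-monoˡ-≤-nonNeg′ (*-nonNeg 0≤x 0≤y) a≤¾)
                          (*-monoˡ-≤-nonNeg′ (*-nonNeg 0≤x 0≤z) b≤1))
                (*-monoˡ-≤-nonNeg′ (*-nonNeg 0≤y 0≤z) c≤1) ⟩
  L
    ≤⟨ p≤p+q (+-mono-≤ (*-nonNeg (nonNegative⁻¹ (+ 4 / 13)) (square-nonNeg (z - (+ 5 / 8) * (x + y))))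
                       (*-nonNeg (nonNegative⁻¹ (+ 3 / 16)) (square-nonNeg (x - y)))) ⟩
  L + ((+ 4 / 13) * ((z - (+ 5 / 8) * (x + y)) * (z - (+ 5 / 8) * (x + y)))
       + (+ 3 / 16) * ((x - y) * (x - y)))
    ≡⟨ sum-of-squares x y z ⟩
  (+ 4 / 13) * ((x + y + z) * (x + y + z)) ∎
  where
  open ≤-Reasoning
  L = x * y * ¾ + x * z * 1ℚ + y * z * 1ℚ
  sum-of-squares : ∀ x y z →
    x * y * ¾ + x * z * 1ℚ + y * z * 1ℚ
      + ((+ 4 / 13) * ((z - (+ 5 / 8) * (x + y)) * (z - (+ 5 / 8) * (x + y)))
         + (+ 3 / 16) * ((x - y) * (x - y)))
    ≡ (+ 4 / 13) * ((x + y + z) * (x + y + z))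
  sum-of-squares = solve-∀ ℚ-ring

triangle-bound : ∀ {x y z a b c} → 0ℚ ≤ x → 0ℚ ≤ y → 0ℚ ≤ z → a ≤ 1ℚ → b ≤ 1ℚ → c ≤ 1ℚ →
                 (¾ < a → ¾ < b → ¾ < c → ⊥) →
                 x * y * a + x * z * b + y * z * c ≤ (+ 4 / 13) * ((x + y + z) * (x + y + z))
triangle-bound {x} {y} {z} {a} {b} {c} 0≤x 0≤y 0≤z a≤1 b≤1 c≤1 not-heavy
  with a ≤? ¾ | b ≤? ¾ | c ≤? ¾
... | yes a≤¾ | _       | _       = light-triangle-bound 0≤x 0≤y 0≤z a≤¾ b≤1 c≤1
... | no _    | yes b≤¾ | _       =
  subst₂ _≤_ (form-xzy x y z a b c) (cong ((+ 4 / 13) *_) (square-xzy x y z))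
    (light-triangle-bound 0≤x 0≤z 0≤y b≤¾ a≤1 c≤1)
  where
  form-xzy : ∀ x y z a b c → x * z * b + x * y * a + z * y * c ≡ x * y * a + x * z * b + y * z * c
  form-xzy = solve-∀ ℚ-ring
  square-xzy : ∀ x y z → (x + z + y) * (x + z + y) ≡ (x + y + z) * (x + y + z)
  square-xzy = solve-∀ ℚ-ring
... | no _    | no _    | yes c≤¾ =
  subst₂ _≤_ (form-yzx x y z a b c) (cong ((+ 4 / 13) *_) (square-yzx x y z))
    (light-triangle-bound 0≤y 0≤z 0≤x c≤¾ a≤1 b≤1)
  where
  form-yzx : ∀ x y z a b c → y * z * c + y * x * a + z * x * b ≡ x * y * a + x * z * b + y * z * c
  form-yzx = solve-∀ ℚ-ring
  square-yzx : ∀ x y z → (y + z + x) * (y + z + x) ≡ (x + y + z) * (x + y + z)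
  square-yzx = solve-∀ ℚ-ring
... | no a≰¾  | no b≰¾  | no c≰¾  = ⊥-elim (not-heavy (≰⇒> a≰¾) (≰⇒> b≰¾) (≰⇒> c≰¾))

-- Adjacency is read off as nonzero weight; no lower bound on the weights is needed.
record Admissible {n} (W : Matrix n) : Set where
  field
    symmetric         : Symmetric W
    hollow            : Hollow W
    ≤1                : ∀ a b → W a b ≤ 1ℚ
    K₄-free           : ∀ a b c d → W a b ≢ 0ℚ → W a c ≢ 0ℚ → W a d ≢ 0ℚ →
                        W b c ≢ 0ℚ → W b d ≢ 0ℚ → W c d ≢ 0ℚ → ⊥
    no-heavy-triangle : ∀ a b c → ¾ < W a b → ¾ < W a c → ¾ < W b c → ⊥

open Admissible

admissible-deleteVertex : ∀ {n} {W : Matrix (suc n)} j → Admissible W → Admissible (deleteVertex j W)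
admissible-deleteVertex j adm = record
  { symmetric         = λ a b → symmetric adm _ _
  ; hollow            = λ a → hollow adm _
  ; ≤1                = λ a b → ≤1 adm _ _
  ; K₄-free           = λ a b c d → K₄-free adm _ _ _ _
  ; no-heavy-triangle = λ a b c → no-heavy-triangle adm _ _ _
  }

-- The right-hand sides of one-edge and three-edges are upperSum W x computed on 2 and 3 vertices.
clique-upperSum-bound : ∀ {n} {W : Matrix n} → Admissible W → IsClique W →
                        ∀ x → (∀ a → 0ℚ ≤ x a) → upperSum W x ≤ (+ 4 / 13) * (sum x * sum x)
clique-upperSum-bound {0} adm _ x x≥0 = ≤-refl
clique-upperSum-bound {1} adm _ x x≥0 = *-nonNeg (nonNegative⁻¹ (+ 4 / 13)) (square-nonNeg (sum x))
clique-upperSum-bound {2} {W} adm _ x x≥0 =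
  subst₂ _≤_ (one-edge (x 0F) (x 1F) (W 0F 1F)) (cong ((+ 4 / 13) *_) (two-vertices (x 0F) (x 1F)))
    (triangle-bound (x≥0 0F) (x≥0 1F) ≤-refl (≤1 adm 0F 1F) (nonNegative⁻¹ 1ℚ) (nonNegative⁻¹ 1ℚ)
      λ _ ¾<0 _ → <-asym ¾<0 (positive⁻¹ ¾))
  where
  one-edge : ∀ x₀ x₁ w → x₀ * x₁ * w + x₀ * 0ℚ * 0ℚ + x₁ * 0ℚ * 0ℚ ≡ (0ℚ + (x₀ * x₁ * w + 0ℚ)) + 0ℚ
  one-edge = solve-∀ ℚ-ring
  two-vertices : ∀ x₀ x₁ → (x₀ + x₁ + 0ℚ) * (x₀ + x₁ + 0ℚ) ≡ (x₀ + (x₁ + 0ℚ)) * (x₀ + (x₁ + 0ℚ))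
  two-vertices = solve-∀ ℚ-ring
clique-upperSum-bound {3} {W} adm _ x x≥0 =
  subst₂ _≤_ (three-edges (x 0F) (x 1F) (x 2F) (W 0F 1F) (W 0F 2F) (W 1F 2F))
    (cong ((+ 4 / 13) *_) (three-vertices (x 0F) (x 1F) (x 2F)))
    (triangle-bound (x≥0 0F) (x≥0 1F) (x≥0 2F) (≤1 adm 0F 1F) (≤1 adm 0F 2F) (≤1 adm 1F 2F)
      (no-heavy-triangle adm 0F 1F 2F))
  where
  three-edges : ∀ x₀ x₁ x₂ w₀₁ w₀₂ w₁₂ →
    x₀ * x₁ * w₀₁ + x₀ * x₂ * w₀₂ + x₁ * x₂ * w₁₂
    ≡ (0ℚ + (x₀ * x₁ * w₀₁ + (x₀ * x₂ * w₀₂ + 0ℚ))) + ((0ℚ + (0ℚ + (x₁ * x₂ * w₁₂ + 0ℚ))) + 0ℚ)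
  three-edges = solve-∀ ℚ-ring
  three-vertices : ∀ x₀ x₁ x₂ →
    (x₀ + x₁ + x₂) * (x₀ + x₁ + x₂) ≡ (x₀ + (x₁ + (x₂ + 0ℚ))) * (x₀ + (x₁ + (x₂ + 0ℚ)))
  three-vertices = solve-∀ ℚ-ring
clique-upperSum-bound {suc (suc (suc (suc n)))} adm clique _ _ =
  ⊥-elim (K₄-free adm 0F 1F 2F 3F (clique 0F 1F λ ()) (clique 0F 2F λ ()) (clique 0F 3F λ ())
                                  (clique 1F 2F λ ()) (clique 1F 3F λ ()) (clique 2F 3F λ ()))

admissible-clique-bound : ∀ {n} {W : Matrix n} → Admissible W → IsClique W → QuadBound (+ 8 / 13) W
admissible-clique-bound {W = W} adm clique x x≥0 = begin
  quad W x
    ≡⟨ quad≡2*upperSum x (symmetric adm) (hollow adm) ⟩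
  2ℚ * upperSum W x
    ≤⟨ *-monoˡ-≤-nonNeg′ (nonNegative⁻¹ 2ℚ) (clique-upperSum-bound adm clique x x≥0) ⟩
  2ℚ * ((+ 4 / 13) * (sum x * sum x))
    ≡⟨ *-assoc 2ℚ (+ 4 / 13) (sum x * sum x) ⟨
  (+ 8 / 13) * (sum x * sum x) ∎
  where open ≤-Reasoning

open Symmetrisation Admissible symmetric hollow admissible-deleteVertex (+ 8 / 13) admissible-clique-bound
  using (quad-bound)

weightMatrix : ∀ {n} (G : Graph n) → Weighting G → Matrix n
weightMatrix G w a b = if adj G a b then wt w a b else 0ℚ

module _ {n} (G : Graph n) (w : Weighting G) where

  private
    W = weightMatrix G w

  weightMatrix-symmetric : Symmetric W
  weightMatrix-symmetric a b rewrite adj-sym G a b | wt-sym w a b = refl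

  weightMatrix-hollow : Hollow W
  weightMatrix-hollow a = cong (if_then wt w a a else 0ℚ) (adj-irrefl G a)

  weightMatrix-≤1 : ∀ a b → W a b ≤ 1ℚ
  weightMatrix-≤1 a b with adj G a b in e
  ... | true  = wt-le1 w a b e
  ... | false = nonNegative⁻¹ 1ℚ

  weightMatrix-nonzero⇒adj : ∀ {a b} → W a b ≢ 0ℚ → adj G a b ≡ true
  weightMatrix-nonzero⇒adj {a} {b} W≢0 with adj G a b
  ... | true  = refl
  ... | false = ⊥-elim (W≢0 refl)

  weightMatrix-heavy : ∀ {a b} → ¾ < W a b → adj G a b ≡ true × ¾ < wt w a b
  weightMatrix-heavy {a} {b} ¾<W with adj G a b
  ... | true  = refl , ¾<W
  ... | false = ⊥-elim (<-asym ¾<W (positive⁻¹ ¾))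

  admissible-weightMatrix : K4-free G → NoHeavyTriangle G w → Admissible W
  admissible-weightMatrix k4-free no-heavy = record
    { symmetric         = weightMatrix-symmetric
    ; hollow            = weightMatrix-hollow
    ; ≤1                = weightMatrix-≤1
    ; K₄-free           = λ a b c d ab ac ad bc bd cd →
        k4-free a b c d (edge ab) (edge ac) (edge ad) (edge bc) (edge bd) (edge cd)
    ; no-heavy-triangle = λ a b c ab ac bc →
        let (eab , hab) = weightMatrix-heavy ab
            (eac , hac) = weightMatrix-heavy ac
            (ebc , hbc) = weightMatrix-heavy bc
        in  no-heavy a b c eab eac ebc hab hac hbc
    }
    where edge = weightMatrix-nonzero⇒adj

  upperSum-weightMatrix : upperSum W (replicate n 1ℚ) ≡ edgeWeightSum G w
  upperSum-weightMatrix = sym (begin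
    edgeWeightSum G w
      ≡⟨ sumFin≡sum n _ ⟩
    ∑[ a < n ] sumFin n (edge-term a)
      ≡⟨ sum-cong-≗ (λ a → trans (sumFin≡sum n (edge-term a)) (sum-cong-≗ (edge-term≡upper a))) ⟩
    upperSum W (replicate n 1ℚ) ∎)
    where
    open ≡-Reasoning
    edge-term : Fin n → Fin n → ℚ
    edge-term a b = if (toℕ a <ᵇ toℕ b) ∧ adj G a b then wt w a b else 0ℚ
    edge-term≡upper : ∀ a b → edge-term a b ≡ upper W (replicate n 1ℚ) a b
    edge-term≡upper a b with toℕ a <ᵇ toℕ b
    ... | true  = sym (*-identityˡ (W a b))
    ... | false = refl

  quad-weightMatrix-ones : quad W (replicate n 1ℚ) ≡ 2ℚ * edgeWeightSum G w
  quad-weightMatrix-ones =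
    trans (quad≡2*upperSum (replicate n 1ℚ) weightMatrix-symmetric weightMatrix-hollow)
          (cong (2ℚ *_) upperSum-weightMatrix)

toℚᵘ-sum-ones : ∀ n → toℚᵘ (sum (replicate n 1ℚ)) ≃ᵘ mkℚᵘ (+ n) 0
toℚᵘ-sum-ones zero    = ℚᵘ.≃-refl
toℚᵘ-sum-ones (suc n) = ℚᵘ.≃-trans (toℚᵘ-homo-+ 1ℚ (sum (replicate n 1ℚ)))
  (ℚᵘ.≃-trans (ℚᵘ.+-congʳ (toℚᵘ 1ℚ) (toℚᵘ-sum-ones n)) (*≡* (add-one (+ n))))
  where
  add-one : ∀ m → (+ 1 ℤ.* + 1 ℤ.+ m ℤ.* + 1) ℤ.* + 1 ≡ (+ 1 ℤ.+ m) ℤ.* + 1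
  add-one = ℤ-solve-∀

two-over-n²-cancel : ∀ k → let n = suc k in
                     (+ 2 / (n ℕ.* n)) * (sum (replicate n 1ℚ) * sum (replicate n 1ℚ)) ≡ 2ℚ
two-over-n²-cancel k = toℚᵘ-injective (begin
  toℚᵘ (p * (N * N))
    ≈⟨ toℚᵘ-homo-* p (N * N) ⟩
  toℚᵘ p ℚᵘ.* toℚᵘ (N * N)
    ≈⟨ ℚᵘ.*-cong (toℚᵘ-fromℚᵘ (mkℚᵘ (+ 2) (k ℕ.+ k ℕ.* n)))
                 (ℚᵘ.≃-trans (toℚᵘ-homo-* N N) (ℚᵘ.*-cong (toℚᵘ-sum-ones n) (toℚᵘ-sum-ones n))) ⟩
  mkℚᵘ (+ 2) (k ℕ.+ k ℕ.* n) ℚᵘ.* (mkℚᵘ (+ n) 0 ℚᵘ.* mkℚᵘ (+ n) 0)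
    ≈⟨ *≡* cross-multiplied ⟩
  mkℚᵘ (+ 2) 0 ∎)
  where
  open ℚᵘ.≃-Reasoning
  n = suc k
  p = + 2 / (n ℕ.* n)
  N = sum (replicate n 1ℚ)
  reassoc : ∀ m → (+ 2 ℤ.* (m ℤ.* m)) ℤ.* + 1 ≡ + 2 ℤ.* ((m ℤ.* m) ℤ.* (+ 1 ℤ.* + 1))
  reassoc = ℤ-solve-∀
  cross-multiplied : (+ 2 ℤ.* (+ n ℤ.* + n)) ℤ.* + 1 ≡ + 2 ℤ.* + ((n ℕ.* n) ℕ.* (1 ℕ.* 1))
  cross-multiplied = trans (reassoc (+ n)) (cong (+ 2 ℤ.*_)
    (trans (cong (ℤ._* + (1 ℕ.* 1)) (sym (ℤ.pos-* n n))) (sym (ℤ.pos-* (n ℕ.* n) (1 ℕ.* 1)))))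

density≤8/13 : ∀ {n} (G : Graph n) (w : Weighting G) → K4-free G → NoHeavyTriangle G w →
               density G w ≤ + 8 / 13
density≤8/13 {zero}  G w _ _ = nonNegative⁻¹ (+ 8 / 13)
density≤8/13 {suc k} G w k4-free no-heavy = *-cancelˡ-≤-pos 2ℚ (begin
  2ℚ * (p * E)                ≡⟨ left-commute 2ℚ p E ⟩
  p * (2ℚ * E)                ≡⟨ cong (p *_) (quad-weightMatrix-ones G w) ⟨
  p * quad W ones             ≤⟨ *-monoˡ-≤-nonNeg′ 0≤p
                                   (quad-bound n (admissible-weightMatrix G w k4-free no-heavy) ones
                                     (λ _ → nonNegative⁻¹ 1ℚ)) ⟩
  p * ((+ 8 / 13) * (N * N))  ≡⟨ left-commute p (+ 8 / 13) (N * N) ⟩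
  (+ 8 / 13) * (p * (N * N))  ≡⟨ cong ((+ 8 / 13) *_) (two-over-n²-cancel k) ⟩
  (+ 8 / 13) * 2ℚ             ≡⟨ *-comm (+ 8 / 13) 2ℚ ⟩
  2ℚ * (+ 8 / 13)             ∎)
  where
  open ≤-Reasoning
  n    = suc k
  p    = + 2 / (n ℕ.* n)
  E    = edgeWeightSum G w
  W    = weightMatrix G w
  ones = replicate n 1ℚ
  N    = sum ones
  0≤p : 0ℚ ≤ p
  0≤p = nonNegative⁻¹ p {{normalize-nonNeg 2 (n ℕ.* n)}}
  left-commute : ∀ a b c → a * (b * c) ≡ b * (a * c)
  left-commute = solve-∀ ℚ-ring

-- No error term is needed: the bound 8/13 holds for every n.
corollary3p4 : (ε : ℚ) → 0ℚ < ε →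
    ∃[ N ] ((n : ℕ) → n ≥ N → (G : Graph n) → (w : Weighting G) →
      K4-free G → NoHeavyTriangle G w →
      density G w ≤ (+ 8) / 13 + ε)
corollary3p4 ε 0<ε = 0 , λ n _ G w k4-free no-heavy →
  ≤-trans (density≤8/13 G w k4-free no-heavy) (p≤p+q (<⇒≤ 0<ε))
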